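{- Let $p\ge 3$ be an integer, let $K_p$ be the complete graph with $V(K_p)=\{v_1,\ldots,v_p\}$, and let $K_{1,q_1},\ldots,K_{1,q_p}$ be stars with $q_j\ge 1$. Let $G$ be the graph obtained by identifying (coalescing) a maximum degree vertex of the star $K_{1,q_j}$ with the vertex $v_j$ of $K_p$, for $j=1,\ldots,p$ (the stars otherwise disjoint). Then $\chi_i'(G)=\omega'(G)$.
   Context: All graphs are finite and simple. $\omega'(G)$ denotes the number of edges in a maximum clique of $G$. Three edges $e_1,e_2,e_3$ (in this order) are consecutive if $e_1=xy$, $e_2=yz$, $e_3=zu$ for some vertices $x,y,z,u$ (where $x=u$ is allowed). An injective edge coloring of $G$ is a map $c:E(G)\to\mathcal{C}$ such that whenever $e_1,e_2,e_3$ are consecutive edges, $c(e_1)\neq c(e_3)$. $\chi_i'(G)$ is the minimum number of colors in an injective edge coloring of $G$. -}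

module Defs where

open import Data.Nat using (ℕ; _≤_; _<_)
open import Data.Nat.Combinatorics using (_C_)
open import Data.Fin using (Fin)
open import Data.Sum using (_⊎_; inj₁; inj₂)
open import Data.Product using (Σ; ∃; _×_; _,_)
open import Data.Empty using (⊥)
open import Data.List using (List; length)
open import Data.List.Relation.Unary.AllPairs using (AllPairs)
open import Relation.Binary.PropositionalEquality using (_≡_; _≢_; sym)
open import Relation.Nullary using (¬_)

record Graph : Set₁ where
  field
    V     : Set
    Adj   : V → V → Set
    adjSymm : ∀ {x y} → Adj x y → Adj y x
    adjIrrefl : ∀ {x} → ¬ Adj x x

open Graph public

-- An edge colouring: colour c x y of the edge xy (only meaningful on
-- edges), independent of the orientation of the edge.
IsEdgeColouring : (G : Graph) → (V G → V G → ℕ) → Set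
IsEdgeColouring G c = ∀ x y → Adj G x y → c x y ≡ c y x

UsesColours : (G : Graph) → (V G → V G → ℕ) → ℕ → Set
UsesColours G c k = ∀ x y → Adj G x y → c x y < k

-- Injective: for consecutive edges e1 = xy, e2 = yz, e3 = zu
-- (three distinct edges: x ≠ z, y ≠ u; x = u allowed), c(e1) ≠ c(e3).
IsInjective : (G : Graph) → (V G → V G → ℕ) → Set
IsInjective G c = ∀ x y z u → Adj G x y → Adj G y z → Adj G z u →
  x ≢ z → y ≢ u → c x y ≢ c z u

InjectiveColouring : (G : Graph) → ℕ → Set
InjectiveColouring G k = Σ (V G → V G → ℕ) λ c →
  IsEdgeColouring G c × IsInjective G c × UsesColours G c k

IsInjChromaticIndex : Graph → ℕ → Set
IsInjChromaticIndex G k =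
  InjectiveColouring G k × (∀ m → InjectiveColouring G m → k ≤ m)

-- A clique: a list of pairwise adjacent (hence distinct) vertices.
Clique : Graph → Set
Clique G = Σ (List (V G)) λ xs → AllPairs (Adj G) xs

cliqueEdges : ∀ {G} → Clique G → ℕ
cliqueEdges (xs , _) = length xs C 2

IsMaxCliqueEdges : Graph → ℕ → Set
IsMaxCliqueEdges G k =
  (Σ (Clique G) λ K → cliqueEdges {G} K ≡ k) ×
  (∀ (K : Clique G) → cliqueEdges {G} K ≤ k)

-- K_p with a star K_{1,q_j} coalesced at v_j (at its maximum-degree vertex),
-- i.e. v_j gets q_j new pendant neighbours (leaf (j , l), l < q_j).
KpStarV : (p : ℕ) → (Fin p → ℕ) → Set
KpStarV p q = Fin p ⊎ Σ (Fin p) (λ j → Fin (q j))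

KpStarAdj : (p : ℕ) (q : Fin p → ℕ) → KpStarV p q → KpStarV p q → Set
KpStarAdj p q (inj₁ i) (inj₁ j) = i ≢ j
KpStarAdj p q (inj₁ i) (inj₂ (j , _)) = i ≡ j
KpStarAdj p q (inj₂ (j , _)) (inj₁ i) = i ≡ j
KpStarAdj p q (inj₂ _) (inj₂ _) = ⊥

private
  adjSym : ∀ p q {x y} → KpStarAdj p q x y → KpStarAdj p q y x
  adjSym p q {inj₁ i} {inj₁ j} ne = λ e → ne (sym e)
  adjSym p q {inj₁ i} {inj₂ _} e = e
  adjSym p q {inj₂ _} {inj₁ i} e = e
  adjSym p q {inj₂ _} {inj₂ _} ()

  adjIrr : ∀ p q {x} → ¬ KpStarAdj p q x x
  adjIrr p q {inj₁ i} ne = ne _≡_.refl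
  adjIrr p q {inj₂ _} ()

KpStars : (p : ℕ) → (Fin p → ℕ) → Graph
KpStars p q = record
  { V = KpStarV p q ; Adj = KpStarAdj p q
  ; adjSymm = adjSym p q ; adjIrrefl = adjIrr p q }

--  * Lower bound, valid in every graph: an injective edge colouring gives
--    pairwise distinct colours to the edges of any clique (two edges of a
--    clique lie on a triangle or on a path of length three inside it), so by
--    pigeonhole a clique with s vertices forces at least s C 2 colours.
--  * Upper bound: a vertex labelling φ by numbers below p induces the edge
--    colouring xy ↦ code of the unordered pair {φx, φy}, with at most p C 2
--    colours. It is injective as soon as φ is proper and never gives the two
--    end edges of a path x–y–z–u the same labelled pair in parallel.
--    A proper labelling by p labels also bounds every clique by p vertices.
--  * For G we label hub v_j by j and each leaf at v_j by a hub label
--    partner j ≠ j (with partner (partner j) ≠ j), which needs p ≥ 3.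
-- The hubs themselves form a clique with p C 2 edges, which finishes the proof.
module Submission where

open import Defs
open import Data.Nat using (ℕ; _≤_)
open import Data.Fin using (Fin)
open import Data.Product using (∃; _×_)

open import Data.Nat using (zero; suc; _+_; _<_; _⊔_; _⊓_; z≤n; s≤s)
open import Data.Nat.Properties
open import Data.Nat.Combinatorics using (_C_; nC1≡n; nCk+nC[k+1]≡[n+1]C[k+1])
open import Data.Fin as Fin using (toℕ; fromℕ<)
open import Data.Fin.Properties using (toℕ-injective; toℕ<n; toℕ-fromℕ<; injective⇒≤)
open import Data.Sum using (_⊎_; inj₁; inj₂)
open import Data.Product using (_,_; proj₁)
open import Data.List using (List; []; _∷_; length; map; lookup; _++_; allFin)
open import Data.List.Properties using (length-map; length-++; length-tabulate)
open import Data.List.Membership.Propositional using (_∈_)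
open import Data.List.Membership.Propositional.Properties using (∈-lookup)
open import Data.List.Relation.Unary.Any using (here; there)
open import Data.List.Relation.Unary.All as All using (All; []; _∷_)
import Data.List.Relation.Unary.All.Properties as All
open import Data.List.Relation.Unary.AllPairs as AllPairs using (AllPairs; []; _∷_)
import Data.List.Relation.Unary.AllPairs.Properties as AllPairs
open import Data.List.Relation.Unary.Unique.Propositional.Properties using (allFin⁺)
open import Relation.Binary.Definitions using (tri<; tri≈; tri>)
open import Relation.Binary.PropositionalEquality
open import Relation.Nullary using (contradiction)
open import Function using (_∘_; id)

lookup-injective : ∀ {A : Set} (xs : List A) → AllPairs _≢_ xs →
  ∀ {i j} → lookup xs i ≡ lookup xs j → i ≡ j
lookup-injective (x ∷ xs) (_ ∷ _)         {Fin.zero}  {Fin.zero}  _ = refl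
lookup-injective (x ∷ xs) (x∉xs ∷ _)      {Fin.zero}  {Fin.suc j} e =
  contradiction e (All.lookup x∉xs (∈-lookup j))
lookup-injective (x ∷ xs) (x∉xs ∷ _)      {Fin.suc i} {Fin.zero}  e =
  contradiction (sym e) (All.lookup x∉xs (∈-lookup i))
lookup-injective (x ∷ xs) (_ ∷ distinct)  {Fin.suc i} {Fin.suc j} e =
  cong Fin.suc (lookup-injective xs distinct e)

distinct-below : ∀ {k} (ns : List ℕ) → AllPairs _≢_ ns → All (_< k) ns → length ns ≤ k
distinct-below {k} ns distinct below = injective⇒≤ {f = index} index-injective
  where
    index : Fin (length ns) → Fin k
    index i = fromℕ< (All.lookup below (∈-lookup i))

    index-injective : ∀ {i j} → index i ≡ index j → i ≡ j
    index-injective {i} {j} e = lookup-injective ns distinct (begin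
      lookup ns i       ≡⟨ sym (toℕ-fromℕ< _) ⟩
      toℕ (index i)     ≡⟨ cong toℕ e ⟩
      toℕ (index j)     ≡⟨ toℕ-fromℕ< _ ⟩
      lookup ns j       ∎)
      where open ≡-Reasoning

-- Triangular numbers: triangle n = n C 2 counts the pairs below n, and
-- triangle b + a (a < b) enumerates them without repetition.

triangle : ℕ → ℕ
triangle zero    = 0
triangle (suc n) = triangle n + n

triangle≡C2 : ∀ n → triangle n ≡ n C 2
triangle≡C2 zero    = refl
triangle≡C2 (suc n) = begin
  triangle n + n     ≡⟨ cong₂ _+_ (triangle≡C2 n) (sym (nC1≡n n)) ⟩
  n C 2 + n C 1      ≡⟨ +-comm (n C 2) (n C 1) ⟩
  n C 1 + n C 2      ≡⟨ nCk+nC[k+1]≡[n+1]C[k+1] n 1 ⟩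
  suc n C 2          ∎
  where open ≡-Reasoning

triangle-mono : ∀ {m n} → m ≤ n → triangle m ≤ triangle n
triangle-mono z≤n       = z≤n
triangle-mono (s≤s m≤n) = +-mono-≤ (triangle-mono m≤n) m≤n

C2-mono : ∀ {m n} → m ≤ n → m C 2 ≤ n C 2
C2-mono {m} {n} m≤n = subst₂ _≤_ (triangle≡C2 m) (triangle≡C2 n) (triangle-mono m≤n)

triangle-offset-< : ∀ {a b c} → a < b → b < c → triangle b + a < triangle c
triangle-offset-< {b = b} a<b b<c = <-≤-trans (+-monoʳ-< (triangle b) a<b) (triangle-mono b<c)

triangle-offset-injective : ∀ {a b a′ b′} → a < b → a′ < b′ →
  triangle b + a ≡ triangle b′ + a′ → b ≡ b′ × a ≡ a′
triangle-offset-injective {a} {b} {a′} {b′} a<b a′<b′ e with <-cmp b b′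
... | tri< b<b′ _ _ = contradiction e (<⇒≢ (<-≤-trans (triangle-offset-< a<b b<b′) (m≤m+n _ a′)))
... | tri≈ _ refl _ = refl , +-cancelˡ-≡ (triangle b) a a′ e
... | tri> _ _ b′<b = contradiction (sym e) (<⇒≢ (<-≤-trans (triangle-offset-< a′<b′ b′<b) (m≤m+n _ a)))

pairCode : ℕ → ℕ → ℕ
pairCode m n = triangle (m ⊔ n) + m ⊓ n

pairCode-comm : ∀ m n → pairCode m n ≡ pairCode n m
pairCode-comm m n = cong₂ _+_ (cong triangle (⊔-comm m n)) (⊓-comm m n)

MinMax : ℕ → ℕ → Set
MinMax m n = (m ⊓ n ≡ m × m ⊔ n ≡ n) ⊎ (m ⊓ n ≡ n × m ⊔ n ≡ m)

minMax : ∀ m n → MinMax m n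
minMax m n with ≤-total m n
... | inj₁ m≤n = inj₁ (m≤n⇒m⊓n≡m m≤n , m≤n⇒m⊔n≡n m≤n)
... | inj₂ n≤m = inj₂ (m≥n⇒m⊓n≡n n≤m , m≥n⇒m⊔n≡m n≤m)

min<max : ∀ {m n} → m ≢ n → m ⊓ n < m ⊔ n
min<max {m} {n} m≢n with minMax m n
... | inj₁ (lo , hi) = subst₂ _<_ (sym lo) (sym hi) (≤∧≢⇒< (subst₂ _≤_ lo hi (m⊓n≤m⊔n m n)) m≢n)
... | inj₂ (lo , hi) = subst₂ _<_ (sym lo) (sym hi) (≤∧≢⇒< (subst₂ _≤_ lo hi (m⊓n≤m⊔n m n)) (≢-sym m≢n))

SamePair : ℕ → ℕ → ℕ → ℕ → Set
SamePair m n m′ n′ = (m ≡ m′ × n ≡ n′) ⊎ (m ≡ n′ × n ≡ m′)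

via : ∀ {a b c d : ℕ} → b ≡ a → b ≡ c → c ≡ d → a ≡ d
via b≡a b≡c c≡d = trans (sym b≡a) (trans b≡c c≡d)

samePair : ∀ {m n m′ n′} → m ⊓ n ≡ m′ ⊓ n′ → m ⊔ n ≡ m′ ⊔ n′ → SamePair m n m′ n′
samePair {m} {n} {m′} {n′} lo≡ hi≡ with minMax m n | minMax m′ n′
... | inj₁ (lo , hi) | inj₁ (lo′ , hi′) = inj₁ (via lo lo≡ lo′ , via hi hi≡ hi′)
... | inj₁ (lo , hi) | inj₂ (lo′ , hi′) = inj₂ (via lo lo≡ lo′ , via hi hi≡ hi′)
... | inj₂ (lo , hi) | inj₁ (lo′ , hi′) = inj₂ (via hi hi≡ hi′ , via lo lo≡ lo′)
... | inj₂ (lo , hi) | inj₂ (lo′ , hi′) = inj₁ (via hi hi≡ hi′ , via lo lo≡ lo′)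

pairCode-injective : ∀ {m n m′ n′} → m ≢ n → m′ ≢ n′ →
  pairCode m n ≡ pairCode m′ n′ → SamePair m n m′ n′
pairCode-injective m≢n m′≢n′ e with triangle-offset-injective (min<max m≢n) (min<max m′≢n′) e
... | hi≡ , lo≡ = samePair lo≡ hi≡

pairCode-< : ∀ {m n p} → m ≢ n → m < p → n < p → pairCode m n < triangle p
pairCode-< m≢n m<p n<p = triangle-offset-< (min<max m≢n) (⊔-lub m<p n<p)

adjacent⇒distinct : ∀ (G : Graph) {x y} → Adj G x y → x ≢ y
adjacent⇒distinct G xy refl = adjIrrefl G xy

clique-members : ∀ (G : Graph) {xs y z} → AllPairs (Adj G) xs → y ∈ xs → z ∈ xs → y ≡ z ⊎ Adj G y z
clique-members G _             (here refl) (here refl) = inj₁ refl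
clique-members G (y~xs ∷ _)    (here refl) (there z∈)  = inj₂ (All.lookup y~xs z∈)
clique-members G (z~xs ∷ _)    (there y∈)  (here refl) = inj₂ (adjSymm G (All.lookup z~xs y∈))
clique-members G (_ ∷ clique)  (there y∈)  (there z∈)  = clique-members G clique y∈ z∈

cliqueColours : ∀ {A : Set} → (A → A → ℕ) → List A → List ℕ
cliqueColours c []       = []
cliqueColours c (x ∷ xs) = map (c x) xs ++ cliqueColours c xs

length-cliqueColours : ∀ {A : Set} (c : A → A → ℕ) xs → length (cliqueColours c xs) ≡ length xs C 2
length-cliqueColours c []       = refl
length-cliqueColours c (x ∷ xs) = begin
  length (map (c x) xs ++ cliqueColours c xs)      ≡⟨ length-++ (map (c x) xs) ⟩
  length (map (c x) xs) + length (cliqueColours c xs)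
    ≡⟨ cong₂ _+_ (trans (length-map (c x) xs) (sym (nC1≡n n))) (length-cliqueColours c xs) ⟩
  n C 1 + n C 2                                    ≡⟨ nCk+nC[k+1]≡[n+1]C[k+1] n 1 ⟩
  suc n C 2                                        ∎
  where
    open ≡-Reasoning
    n : ℕ
    n = length xs

module CliqueEdges (G : Graph) (c : V G → V G → ℕ)
                   (symmetric : IsEdgeColouring G c) (injective : IsInjective G c) where

  -- the sides xy and zx of a triangle are consecutive through yz
  triangle-colours : ∀ {x y z} → Adj G x y → Adj G y z → Adj G z x → c x y ≢ c z x
  triangle-colours xy yz zx =
    injective _ _ _ _ xy yz zx (adjacent⇒distinct G (adjSymm G zx)) (adjacent⇒distinct G (adjSymm G xy))

  -- Edges xy and zw of a clique {x, y, z, w} with z ≠ w, x ∉ {z, w} and xy ≠ zw: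
  -- if they share y they lie on a triangle, otherwise x–y–z–w is a path.
  edge-colours : ∀ {x y z w} → Adj G x y → Adj G x z → Adj G x w → Adj G z w →
    y ≡ z ⊎ Adj G y z → y ≡ w ⊎ Adj G y w → c x y ≢ c z w
  edge-colours {x} {y} {z} {w} xy xz xw zw (inj₁ refl) _ e =
    triangle-colours (adjSymm G xy) xw (adjSymm G zw)
      (trans (symmetric y x (adjSymm G xy)) (trans e (symmetric y w zw)))
  edge-colours {x} {y} xy xz xw zw (inj₂ _) (inj₁ refl) e =
    triangle-colours (adjSymm G xy) xz zw (trans (symmetric y x (adjSymm G xy)) e)
  edge-colours xy xz xw zw (inj₂ yz) (inj₂ yw) =
    injective _ _ _ _ xy yz zw (adjacent⇒distinct G xz) (adjacent⇒distinct G yw)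

  fan-distinct : ∀ {x ys} → All (Adj G x) ys → AllPairs (Adj G) ys → AllPairs _≢_ (map (c x) ys)
  fan-distinct []          []             = []
  fan-distinct {x} {y ∷ ys} (xy ∷ x~ys) (y~ys ∷ clique) =
    All.map⁺ (All.tabulate λ z∈ → separate (All.lookup x~ys z∈) (All.lookup y~ys z∈))
      ∷ fan-distinct x~ys clique
    where
      separate : ∀ {z} → Adj G x z → Adj G y z → c x y ≢ c x z
      separate xz yz e = triangle-colours xy yz (adjSymm G xz) (trans e (symmetric x _ xz))

  edge-vs-clique : ∀ {x y zs} → Adj G x y → All (Adj G x) zs →
    All (λ z → y ≡ z ⊎ Adj G y z) zs → AllPairs (Adj G) zs → All (c x y ≢_) (cliqueColours c zs)
  edge-vs-clique xy []           []             []                 = []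
  edge-vs-clique xy (xz ∷ x~zs) (yz ∷ y~zs) (z~zs ∷ clique) = All.++⁺
    (All.map⁺ (All.tabulate λ w∈ →
      edge-colours xy xz (All.lookup x~zs w∈) (All.lookup z~zs w∈) yz (All.lookup y~zs w∈)))
    (edge-vs-clique xy x~zs y~zs clique)

  cliqueColours-distinct : ∀ {xs} → AllPairs (Adj G) xs → AllPairs _≢_ (cliqueColours c xs)
  cliqueColours-distinct []                 = []
  cliqueColours-distinct (x~xs ∷ clique) = AllPairs.++⁺
    (fan-distinct x~xs clique)
    (cliqueColours-distinct clique)
    (All.map⁺ (All.tabulate λ y∈ → edge-vs-clique (All.lookup x~xs y∈) x~xs
      (All.tabulate (clique-members G clique y∈)) clique))

cliqueColours-below : ∀ (G : Graph) {c k} → UsesColours G c k →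
  ∀ {xs} → AllPairs (Adj G) xs → All (_< k) (cliqueColours c xs)
cliqueColours-below G uses []                 = []
cliqueColours-below G uses {x ∷ _} (x~xs ∷ clique) =
  All.++⁺ (All.map⁺ (All.map (uses x _) x~xs)) (cliqueColours-below G uses clique)

clique-edges≤colours : ∀ (G : Graph) {k} → InjectiveColouring G k → (K : Clique G) →
  cliqueEdges {G} K ≤ k
clique-edges≤colours G (c , symmetric , injective , uses) (xs , clique) =
  subst (_≤ _) (length-cliqueColours c xs)
    (distinct-below (cliqueColours c xs)
      (CliqueEdges.cliqueColours-distinct G c symmetric injective clique)
      (cliqueColours-below G uses clique))

module Labelling (G : Graph) (φ : V G → ℕ) where

  Proper : Set
  Proper = ∀ {x y} → Adj G x y → φ x ≢ φ y

  NoParallelRepeat : Set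
  NoParallelRepeat = ∀ {x y z u} → Adj G x y → Adj G y z → Adj G z u →
    x ≢ z → y ≢ u → φ x ≡ φ z → φ y ≢ φ u

  labelColouring : V G → V G → ℕ
  labelColouring x y = pairCode (φ x) (φ y)

  labelColouring-symmetric : IsEdgeColouring G labelColouring
  labelColouring-symmetric x y _ = pairCode-comm (φ x) (φ y)

  labelColouring-below : ∀ {p} → Proper → (∀ x → φ x < p) → UsesColours G labelColouring (triangle p)
  labelColouring-below proper φ<p x y xy = pairCode-< (proper xy) (φ<p x) (φ<p y)

  -- a repeated label pair on consecutive edges is either parallel (excluded by
  -- the path condition) or crossed, which would put equal labels on the middle edge yz
  labelColouring-injective : Proper → NoParallelRepeat → IsInjective G labelColouring
  labelColouring-injective proper noRepeat x y z u xy yz zu x≢z y≢u e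
    with pairCode-injective (proper xy) (proper zu) e
  ... | inj₁ (φx≡φz , φy≡φu) = noRepeat xy yz zu x≢z y≢u φx≡φz φy≡φu
  ... | inj₂ (_ , φy≡φz)     = proper yz φy≡φz

  clique-size≤labels : ∀ {p} → Proper → (∀ x → φ x < p) → (K : Clique G) → length (proj₁ K) ≤ p
  clique-size≤labels proper φ<p (xs , clique) =
    subst (_≤ _) (length-map φ xs)
      (distinct-below (map φ xs) (AllPairs.map⁺ (AllPairs.map proper clique)) (All.map⁺ (All.tabulate λ {x} _ → φ<p x)))

partner : ℕ → ℕ
partner 0 = 1
partner 1 = 2
partner _ = 0

partner-≢ : ∀ n → partner n ≢ n
partner-≢ 0 ()
partner-≢ 1 ()
partner-≢ (suc (suc n)) ()

partner²-≢ : ∀ n → partner (partner n) ≢ n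
partner²-≢ 0 ()
partner²-≢ 1 ()
partner²-≢ (suc (suc n)) ()

partner<3 : ∀ n → partner n < 3
partner<3 0             = s≤s (s≤s z≤n)
partner<3 1             = s≤s (s≤s (s≤s z≤n))
partner<3 (suc (suc n)) = s≤s z≤n

module KpWithStars (p : ℕ) (q : Fin p → ℕ) where

  G : Graph
  G = KpStars p q

  label : KpStarV p q → ℕ
  label (inj₁ i)       = toℕ i
  label (inj₂ (j , _)) = partner (toℕ j)

  open Labelling G label

  label-proper : Proper
  label-proper {inj₁ i}       {inj₁ j}       i≢j  = i≢j ∘ toℕ-injective
  label-proper {inj₁ i}       {inj₂ (.i , _)} refl = ≢-sym (partner-≢ (toℕ i))
  label-proper {inj₂ (j , _)} {inj₁ .j}      refl = partner-≢ (toℕ j)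

  label-below : 3 ≤ p → ∀ x → label x < p
  label-below _   (inj₁ i)       = toℕ<n i
  label-below 3≤p (inj₂ (j , _)) = <-≤-trans (partner<3 (toℕ j)) 3≤p

  -- A leaf has the single neighbour v_j, so the middle edge yz of the path joins
  -- two hubs; then a parallel repeat can only be leaf–v_j–v_k–leaf with
  -- partner j = k and j = partner k, impossible.
  label-noParallelRepeat : NoParallelRepeat
  label-noParallelRepeat {inj₁ _} {inj₂ _} {inj₁ _} refl refl _ x≢z = contradiction refl x≢z
  label-noParallelRepeat {inj₂ _} {inj₂ _} () _ _
  label-noParallelRepeat {_} {inj₁ _} {inj₂ _} {inj₁ _} _ refl refl _ y≢u = contradiction refl y≢u
  label-noParallelRepeat {_} {inj₁ _} {inj₂ _} {inj₂ _} _ _ () _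
  label-noParallelRepeat {_} {inj₁ j} {inj₁ k} {inj₁ m} _ _ _ _ y≢u _ j≡m =
    y≢u (cong inj₁ (toℕ-injective j≡m))
  label-noParallelRepeat {inj₁ i} {inj₁ j} {inj₁ k} {inj₂ (.k , _)} _ _ refl x≢z _ i≡k =
    contradiction (cong inj₁ (toℕ-injective i≡k)) x≢z
  label-noParallelRepeat {inj₂ (.j , _)} {inj₁ j} {inj₁ k} {inj₂ (.k , _)} refl _ refl _ _ pj≡k j≡pk =
    partner²-≢ (toℕ k) (trans (cong partner (sym j≡pk)) pj≡k)

  clique-edges≤ : 3 ≤ p → (K : Clique G) → cliqueEdges {G} K ≤ p C 2
  clique-edges≤ 3≤p K = C2-mono (clique-size≤labels label-proper (label-below 3≤p) K)

  labelInjectiveColouring : 3 ≤ p → InjectiveColouring G (p C 2)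
  labelInjectiveColouring 3≤p =
    labelColouring , labelColouring-symmetric ,
    labelColouring-injective label-proper label-noParallelRepeat ,
    subst (UsesColours G labelColouring) (triangle≡C2 p) (labelColouring-below label-proper (label-below 3≤p))

  hubs : Clique G
  hubs = map inj₁ (allFin p) , AllPairs.map⁺ (allFin⁺ p)

  hubs-edges : cliqueEdges {G} hubs ≡ p C 2
  hubs-edges = cong (_C 2) (trans (length-map inj₁ (allFin p)) (length-tabulate {n = p} id))

proposition6 : (p : ℕ) (q : Fin p → ℕ) → 3 ≤ p → (∀ j → 1 ≤ q j) →
    ∃ λ k → IsMaxCliqueEdges (KpStars p q) k × IsInjChromaticIndex (KpStars p q) k
proposition6 p q 3≤p _ =
  p C 2 , ((hubs , hubs-edges) , clique-edges≤ 3≤p) , labelInjectiveColouring 3≤p , colours≥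
  where
    open KpWithStars p q

    colours≥ : ∀ m → InjectiveColouring G m → p C 2 ≤ m
    colours≥ m colouring = subst (_≤ m) hubs-edges (clique-edges≤colours G colouring hubs)
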